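{- The directed graph $D_3(4)$ admits a decomposition of its arc set into three arc-disjoint directed Hamilton cycles.
   Context: $D_3(4)$ is the directed graph with vertex set $(\mathbb Z_4)^3$ and arcs $v\to v+(1,0,0)$, $v\to v+(0,1,0)$, $v\to v+(0,0,1)$ (mod $4$), $192$ arcs in total. A directed Hamilton cycle passes through all $64$ vertices. -}

module Defs where

open import Data.Nat using (ℕ; suc)
open import Data.Nat.DivMod using (_%_; m%n<n)
open import Data.Fin using (Fin; zero; suc; toℕ; fromℕ<)
open import Data.Product using (Σ; _×_; _,_; ∃-syntax)
open import Relation.Binary.PropositionalEquality using (_≡_; _≢_)
open import Function.Definitions using (Injective)
open import Data.Empty using (⊥)

sucMod : (n : ℕ) → Fin (suc n) → Fin (suc n)
sucMod n k = fromℕ< (m%n<n (suc (toℕ k)) (suc n))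

Vertex : Set
Vertex = Fin 4 × Fin 4 × Fin 4

step : Vertex → Fin 3 → Vertex
step (a , b , c) zero = (sucMod 3 a , b , c)
step (a , b , c) (suc zero) = (a , sucMod 3 b , c)
step (a , b , c) (suc (suc zero)) = (a , b , sucMod 3 c)

IsArc : Vertex → Vertex → Set
IsArc u w = ∃[ i ] step u i ≡ w

-- A directed Hamilton cycle: a cyclic ordering of all 64 vertices
-- (injective map from positions ℤ₆₄), consecutive vertices joined by arcs.
record HamCycle : Set where
  field
    seq    : Fin 64 → Vertex
    inj    : Injective _≡_ _≡_ seq
    arcs   : ∀ k → IsArc (seq k) (seq (sucMod 63 k))

open HamCycle public

UsesArc : HamCycle → Vertex → Vertex → Set
UsesArc H u w = ∃[ k ] (seq H k ≡ u × seq H (sucMod 63 k) ≡ w)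

record HamDecomposition3 : Set where
  field
    cycle    : Fin 3 → HamCycle
    covers   : ∀ u w → IsArc u w → ∃[ j ] UsesArc (cycle j) u w
    disjoint : ∀ j j' u w → j ≢ j' → UsesArc (cycle j) u w → UsesArc (cycle j') u w → ⊥

{-# OPTIONS --safe #-}
module Submission where

-- A Hamilton decomposition amounts to a routing: at every vertex v a bijection j ↦ dᵥ(j)
-- sending cycle j out of v along direction dᵥ(j), such that each successor map
-- v ↦ v + e_{dᵥ(j)} cyclically permutes all 64 vertices. Every arc is then used because dᵥ is
-- onto, and only once because dᵥ is one-to-one and distinct directions give distinct arcs.
-- For an explicit routing, each successor map is checked to be injective with the origin
-- first returning at time 64 and visiting every vertex, so its orbit is a Hamilton cycle.

open import Defs
open import Data.Nat using (ℕ; zero; suc; _+_; _*_; _∸_; _<_; _<?_; NonZero)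
open import Data.Nat.DivMod using (_%_; _/_; m≡m%n+[m/n]*n; m%n<n)
open import Data.Nat.GeneralisedArithmetic using (iterate)
open import Data.Nat.Properties using (+-comm; <-cmp; <⇒≤; ≤-<-trans; m∸n≤m; m∸n+n≡m; m<n⇒0<n∸m; allUpTo?)
open import Data.Fin using (Fin; zero; suc; toℕ; #_)
open import Data.Fin.Properties using (all?; any?; toℕ-fromℕ<; toℕ<n; toℕ-injective) renaming (_≟_ to _≟ᶠ_)
open import Data.Vec using (Vec; []; _∷_; lookup)
open import Data.Product using (_,_; proj₁; proj₂; ∃-syntax)
open import Data.Product.Properties using (≡-dec)
open import Data.Empty using (⊥)
open import Function.Base using (_∘_)
open import Function.Definitions using (Injective)
open import Relation.Binary.Definitions using (DecidableEquality; tri<; tri≈; tri>)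
open import Relation.Binary.PropositionalEquality using (_≡_; _≢_; refl; sym; trans; cong; module ≡-Reasoning)
open import Relation.Nullary using (Dec; yes; no; ¬?; contradiction)
open import Relation.Nullary.Decidable using (toWitness; _→-dec_)
open import Relation.Unary using (Decidable)

module _ {A : Set} (f : A → A) where

  iterate-suc : ∀ x n → iterate f x (suc n) ≡ f (iterate f x n)
  iterate-suc x zero    = refl
  iterate-suc x (suc n) = iterate-suc (f x) n

  iterate-+ : ∀ x m n → iterate f x (m + n) ≡ iterate f (iterate f x m) n
  iterate-+ x zero    n = refl
  iterate-+ x (suc m) n = iterate-+ (f x) m n

  iterate-periodic : ∀ {x n} → iterate f x n ≡ x → ∀ q → iterate f x (q * n) ≡ x
  iterate-periodic         period zero    = refl
  iterate-periodic {x} {n} period (suc q) = begin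
    iterate f x (n + q * n)             ≡⟨ iterate-+ x n (q * n) ⟩
    iterate f (iterate f x n) (q * n)   ≡⟨ cong (λ y → iterate f y (q * n)) period ⟩
    iterate f x (q * n)                 ≡⟨ iterate-periodic period q ⟩
    x                                   ∎
    where open ≡-Reasoning

  iterate-% : ∀ {x n} .{{_ : NonZero n}} → iterate f x n ≡ x →
              ∀ m → iterate f x (m % n) ≡ iterate f x m
  iterate-% {x} {n} period m = begin
    iterate f x (m % n)                           ≡⟨ cong (λ y → iterate f y (m % n)) (iterate-periodic period (m / n)) ⟨
    iterate f (iterate f x (m / n * n)) (m % n)   ≡⟨ iterate-+ x (m / n * n) (m % n) ⟨
    iterate f x (m / n * n + m % n)               ≡⟨ cong (iterate f x) (+-comm (m / n * n) (m % n)) ⟩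
    iterate f x (m % n + m / n * n)               ≡⟨ cong (iterate f x) (m≡m%n+[m/n]*n m n) ⟨
    iterate f x m                                 ∎
    where open ≡-Reasoning

  orbit : ∀ {n} → A → Fin n → A
  orbit x k = iterate f x (toℕ k)

  NoReturnBefore : ℕ → A → Set
  NoReturnBefore n x = ∀ {d} → d < n → 0 < d → iterate f x d ≢ x

  iterate-cancel : Injective _≡_ _≡_ f → ∀ n {x y} → iterate f x n ≡ iterate f y n → x ≡ y
  iterate-cancel f-injective zero    eq = eq
  iterate-cancel f-injective (suc n) eq = f-injective (iterate-cancel f-injective n eq)

  iterate-distinct : ∀ {x n} → Injective _≡_ _≡_ f → NoReturnBefore n x →
                     ∀ {a b} → a < b → b < n → iterate f x a ≢ iterate f x b
  iterate-distinct {x} f-injective no-early-return {a} {b} a<b b<n eq =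
    no-early-return (≤-<-trans (m∸n≤m b a) b<n) (m<n⇒0<n∸m a<b) (iterate-cancel f-injective a (begin
      iterate f (iterate f x (b ∸ a)) a   ≡⟨ iterate-+ x (b ∸ a) a ⟨
      iterate f x (b ∸ a + a)             ≡⟨ cong (iterate f x) (m∸n+n≡m (<⇒≤ a<b)) ⟩
      iterate f x b                       ≡⟨ eq ⟨
      iterate f x a                       ∎))
    where open ≡-Reasoning

  orbit-injective : ∀ {x n} → Injective _≡_ _≡_ f → NoReturnBefore n x →
                    Injective _≡_ _≡_ (orbit {n} x)
  orbit-injective f-injective no-early-return {a} {b} eq with <-cmp (toℕ a) (toℕ b)
  ... | tri< a<b _ _ = contradiction eq (iterate-distinct f-injective no-early-return a<b (toℕ<n b))
  ... | tri≈ _ a≡b _ = toℕ-injective a≡b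
  ... | tri> _ _ b<a = contradiction (sym eq) (iterate-distinct f-injective no-early-return b<a (toℕ<n a))

  orbit-sucMod : ∀ {x n} → iterate f x (suc n) ≡ x → ∀ k → orbit x (sucMod n k) ≡ f (orbit x k)
  orbit-sucMod {x} {n} period k = begin
    iterate f x (toℕ (sucMod n k))      ≡⟨ cong (iterate f x) (toℕ-fromℕ< (m%n<n (suc (toℕ k)) (suc n))) ⟩
    iterate f x (suc (toℕ k) % suc n)   ≡⟨ iterate-% {n = suc n} period (suc (toℕ k)) ⟩
    iterate f x (suc (toℕ k))           ≡⟨ iterate-suc x (toℕ k) ⟩
    f (orbit x k)                       ∎
    where open ≡-Reasoning

sucMod-fixfree : ∀ a → sucMod 3 a ≢ a
sucMod-fixfree zero ()
sucMod-fixfree (suc zero) ()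
sucMod-fixfree (suc (suc zero)) ()
sucMod-fixfree (suc (suc (suc zero))) ()

step-injective : ∀ u {i i'} → step u i ≡ step u i' → i ≡ i'
step-injective (a , b , c) {zero}             {zero}             e = refl
step-injective (a , b , c) {zero}             {suc zero}         e = contradiction (cong proj₁ e) (sucMod-fixfree a)
step-injective (a , b , c) {zero}             {suc (suc zero)}   e = contradiction (cong proj₁ e) (sucMod-fixfree a)
step-injective (a , b , c) {suc zero}         {zero}             e = contradiction (sym (cong proj₁ e)) (sucMod-fixfree a)
step-injective (a , b , c) {suc zero}         {suc zero}         e = refl
step-injective (a , b , c) {suc zero}         {suc (suc zero)}   e = contradiction (cong (proj₁ ∘ proj₂) e) (sucMod-fixfree b)
step-injective (a , b , c) {suc (suc zero)}   {zero}             e = contradiction (sym (cong proj₁ e)) (sucMod-fixfree a)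
step-injective (a , b , c) {suc (suc zero)}   {suc zero}         e = contradiction (sym (cong (proj₁ ∘ proj₂) e)) (sucMod-fixfree b)
step-injective (a , b , c) {suc (suc zero)}   {suc (suc zero)}   e = refl

Follows : (Vertex → Vertex) → HamCycle → Set
Follows f H = ∀ k → seq H (sucMod 63 k) ≡ f (seq H k)

follows-usesArc : ∀ H {f u w} → Follows f H → UsesArc H u w → w ≡ f u
follows-usesArc H follows (k , refl , refl) = follows k

orbitCycle : (f : Vertex → Vertex) → (∀ v → IsArc v (f v)) →
             (x : Vertex) → Injective _≡_ _≡_ (orbit f {64} x) → iterate f x 64 ≡ x → HamCycle
orbitCycle f arc x injective period = record
  { seq  = orbit f x
  ; inj  = injective
  ; arcs = λ k → let (i , e) = arc (orbit f x k) in i , trans e (sym (orbit-sucMod f period k))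
  }

-- Stated for an abstract f: checking orbit-sucMod directly against
-- Follows (successor direction j) (orbitCycle …) exhausts memory in the conversion checker.
orbitCycle-follows : ∀ f arc x (injective : Injective _≡_ _≡_ (orbit f {64} x)) (period : iterate f x 64 ≡ x) →
                     Follows f (orbitCycle f arc x injective period)
orbitCycle-follows f arc x injective period = orbit-sucMod f period

successor : (Fin 3 → Vertex → Fin 3) → Fin 3 → Vertex → Vertex
successor direction j v = step v (direction j v)

decomposition : (direction : Fin 3 → Vertex → Fin 3) (H : Fin 3 → HamCycle) →
                (∀ v → Injective _≡_ _≡_ (λ j → direction j v)) →
                (∀ v i → ∃[ j ] direction j v ≡ i) →
                (∀ j → Follows (successor direction j) (H j)) →
                (∀ j v → ∃[ k ] seq (H j) k ≡ v) →
                HamDecomposition3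
decomposition direction H direction-injective direction-surjective follows H-surjective = record
  { cycle    = H
  ; covers   = covers
  ; disjoint = disjoint
  }
  where
  covers : ∀ u w → IsArc u w → ∃[ j ] UsesArc (H j) u w
  covers u _ (i , refl) with j , refl ← direction-surjective u i
                        with k , refl ← H-surjective j u
    = j , k , refl , follows j k

  disjoint : ∀ j j' u w → j ≢ j' → UsesArc (H j) u w → UsesArc (H j') u w → ⊥
  disjoint j j' u w j≢j' uses uses' = j≢j' (direction-injective u (step-injective u same-head))
    where
    same-head : successor direction j u ≡ successor direction j' u
    same-head = trans (sym (follows-usesArc (H j) (follows j) uses)) (follows-usesArc (H j') (follows j') uses')

orbitDecomposition : (direction : Fin 3 → Vertex → Fin 3) (x : Vertex) →
                     (∀ v → Injective _≡_ _≡_ (λ j → direction j v)) →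
                     (∀ v i → ∃[ j ] direction j v ≡ i) →
                     (∀ j → Injective _≡_ _≡_ (successor direction j)) →
                     (∀ j → NoReturnBefore (successor direction j) 64 x) →
                     (∀ j → iterate (successor direction j) x 64 ≡ x) →
                     (∀ j v → ∃[ k ] orbit (successor direction j) {64} x k ≡ v) →
                     HamDecomposition3
orbitDecomposition direction x direction-injective direction-surjective
                   successor-injective no-early-return period orbit-surjective =
  decomposition direction cycle direction-injective direction-surjective
    (λ j → orbitCycle-follows (successor direction j) (arc j) x (injective j) (period j)) orbit-surjective
  where
  arc : ∀ j v → IsArc v (successor direction j v)
  arc j v = direction j v , refl

  injective : ∀ j → Injective _≡_ _≡_ (orbit (successor direction j) {64} x)
  injective j = orbit-injective (successor direction j) (successor-injective j) (no-early-return j)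

  cycle : Fin 3 → HamCycle
  cycle j = orbitCycle (successor direction j) (arc j) x (injective j) (period j)

_≟ᵛ_ : DecidableEquality Vertex
_≟ᵛ_ = ≡-dec _≟ᶠ_ (≡-dec _≟ᶠ_ _≟ᶠ_)

all-vertices? : {P : Vertex → Set} → Decidable P → Dec (∀ v → P v)
all-vertices? P? with all? (λ a → all? (λ b → all? (λ c → P? (a , b , c))))
... | yes p = yes (λ { (a , b , c) → p a b c })
... | no ¬p = no (λ p → ¬p (λ a b c → p (a , b , c)))

injective? : {A B : Set} → (∀ {P : A → Set} → Decidable P → Dec (∀ a → P a)) →
             DecidableEquality A → DecidableEquality B → (f : A → B) → Dec (Injective _≡_ _≡_ f)
injective? ∀? _≟ᴬ_ _≟ᴮ_ f with ∀? (λ a → ∀? (λ a' → (f a ≟ᴮ f a') →-dec (a ≟ᴬ a')))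
... | yes p = yes (λ {a} {a'} → p a a')
... | no ¬p = no (λ injective → ¬p (λ a a' → injective))

-- dijk : cycles 0, 1, 2 leave the vertex along directions i, j, k.
d012 d021 d102 d120 d201 d210 : Vec (Fin 3) 3
d012 = # 0 ∷ # 1 ∷ # 2 ∷ []
d021 = # 0 ∷ # 2 ∷ # 1 ∷ []
d102 = # 1 ∷ # 0 ∷ # 2 ∷ []
d120 = # 1 ∷ # 2 ∷ # 0 ∷ []
d201 = # 2 ∷ # 0 ∷ # 1 ∷ []
d210 = # 2 ∷ # 1 ∷ # 0 ∷ []

routingTable : Vec (Vec (Vec (Vec (Fin 3) 3) 4) 4) 4
routingTable =
    ( (d012 ∷ d210 ∷ d210 ∷ d201 ∷ [])
    ∷ (d201 ∷ d201 ∷ d201 ∷ d012 ∷ [])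
    ∷ (d201 ∷ d021 ∷ d012 ∷ d021 ∷ [])
    ∷ (d210 ∷ d012 ∷ d210 ∷ d021 ∷ []) ∷ [])
  ∷ ( (d120 ∷ d021 ∷ d102 ∷ d012 ∷ [])
    ∷ (d201 ∷ d012 ∷ d012 ∷ d012 ∷ [])
    ∷ (d102 ∷ d012 ∷ d102 ∷ d210 ∷ [])
    ∷ (d012 ∷ d120 ∷ d102 ∷ d120 ∷ []) ∷ [])
  ∷ ( (d102 ∷ d201 ∷ d012 ∷ d021 ∷ [])
    ∷ (d021 ∷ d012 ∷ d120 ∷ d102 ∷ [])
    ∷ (d012 ∷ d102 ∷ d120 ∷ d210 ∷ [])
    ∷ (d120 ∷ d012 ∷ d201 ∷ d012 ∷ []) ∷ [])
  ∷ ( (d210 ∷ d012 ∷ d120 ∷ d201 ∷ [])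
    ∷ (d012 ∷ d120 ∷ d210 ∷ d102 ∷ [])
    ∷ (d012 ∷ d201 ∷ d021 ∷ d012 ∷ [])
    ∷ (d021 ∷ d201 ∷ d012 ∷ d201 ∷ []) ∷ [])
  ∷ []

routing : Fin 3 → Vertex → Fin 3
routing j (a , b , c) = lookup (lookup (lookup (lookup routingTable a) b) c) j

origin : Vertex
origin = zero , zero , zero

routing-injective : ∀ v → Injective _≡_ _≡_ (λ j → routing j v)
routing-injective = toWitness {a? = all-vertices? (λ v → injective? all? _≟ᶠ_ _≟ᶠ_ (λ j → routing j v))} _

routing-surjective : ∀ v i → ∃[ j ] routing j v ≡ i
routing-surjective = toWitness {a? = all-vertices? (λ v → all? (λ i → any? (λ j → routing j v ≟ᶠ i)))} _

routing-successor-injective : ∀ j → Injective _≡_ _≡_ (successor routing j)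
routing-successor-injective = toWitness {a? = all? (λ j → injective? all-vertices? _≟ᵛ_ _≟ᵛ_ (successor routing j))} _

routing-no-early-return : ∀ j → NoReturnBefore (successor routing j) 64 origin
routing-no-early-return = toWitness
  {a? = all? (λ j → allUpTo? (λ d → (0 <? d) →-dec ¬? (iterate (successor routing j) origin d ≟ᵛ origin)) 64)} _

routing-returns : ∀ j → iterate (successor routing j) origin 64 ≡ origin
routing-returns = toWitness {a? = all? (λ j → iterate (successor routing j) origin 64 ≟ᵛ origin)} _

routing-orbit-surjective : ∀ j v → ∃[ k ] orbit (successor routing j) {64} origin k ≡ v
routing-orbit-surjective = toWitness
  {a? = all? (λ j → all-vertices? (λ v → any? (λ k → orbit (successor routing j) origin k ≟ᵛ v)))} _

proposition5p1 : HamDecomposition3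
proposition5p1 = orbitDecomposition routing origin routing-injective routing-surjective
  routing-successor-injective routing-no-early-return routing-returns routing-orbit-surjective
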